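{- Let $\mathcal{N}$ be a tree-child network on $X$, let $\mathcal{C}$ be a tight caterpillar ladder of $\mathcal{N}$, and let $e$ be the first or last rung of $\mathcal{C}$. If $\mathcal{C}'$ is a tight caterpillar ladder of $\mathcal{N}\setminus\{e\}$, then either $\mathcal{C}'$ or a tight caterpillar ladder equivalent to $\mathcal{C}'$ is a tight caterpillar ladder of $\mathcal{N}$.
   Context: A (rooted binary) phylogenetic network on a finite nonempty set $X$ is a rooted acyclic directed graph with no parallel arcs such that the root has in-degree 0 and out-degree 2; the leaves (out-degree 0) have in-degree 1 and are exactly the elements of $X$; every other vertex is a tree vertex (in-degree 1, out-degree 2) or a reticulation (in-degree 2, out-degree 1). A tree path is a directed path $v_1,\dots,v_n$ ($n\ge1$) with each of $v_2,\dots,v_n$ a tree vertex or a leaf. The network is tree-child if every non-leaf vertex has a child that is a tree vertex or a leaf. For a reticulation arc $e=(u,v)$ (arc into a reticulation) of a tree-child network $\mathcal{N}$, $\mathcal{N}\setminus\{e\}$ is obtained by deleting $e$ and suppressing $u$ and $v$ (now of in- and out-degree 1) if $u$ is not the root, and by deleting both arcs incident with $u$ and suppressing $v$ if $u$ is the root; its vertices are thus vertices of $\mathcal{N}$. Caterpillar ladder: for $k\ge1$ and distinct labels $\ell_0,\dots,\ell_k$, $\langle\ell_0,\dots,\ell_k\rangle$ has vertices $\ell_0,\dots,\ell_k$ and $v_j,p_j,q_j$ ($1\le j\le k$); arcs: if $k=1$, $(q_1,p_1)$ and $(p_1,\ell_0)$; if $k\ge2$, the arcs of the directed path $q_k,q_{k-1},p_k,q_{k-2},p_{k-1},\dots,q_2,p_3,q_1,p_2,p_1,\ell_0$;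 and for each $j$, $(p_j,v_j),(q_j,v_j),(v_j,\ell_j)$. The spine is the path $q_k,q_{k-1},p_k,\dots,q_1,p_2,p_1$ (the arc $(q_1,p_1)$ if $k=1$); its vertices are the spine vertices and $v_1,\dots,v_k$ the reticulations of the ladder. It is a tight caterpillar ladder of a network $\mathcal{M}$ if its leaves lie in $X$ and there is an injective map $\phi$ from its vertices to those of $\mathcal{M}$ with $\phi(\ell_j)=\ell_j$ such that (P1) there are tree paths in $\mathcal{M}$ from $\phi(p_1)$ to $\ell_0$ and from $\phi(v_j)$ to $\ell_j$ for each $j\ge1$; (P2) $(\phi(p_j),\phi(v_j))$ and $(\phi(q_j),\phi(v_j))$ are arcs of $\mathcal{M}$; (P3) for each spine arc $(u,w)$, $(\phi(u),\phi(w))$ is an arc of $\mathcal{M}$. Its first rung is $(\phi(p_1),\phi(v_1))$ and last rung is $(\phi(q_k),\phi(v_k))$. Two tight caterpillar ladders are equivalent if the images of their reticulations and spine vertices form the same vertex set. -}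

module Defs where

open import Data.Nat using (ℕ; zero; suc; _≤_; _≟_)
open import Data.Product using (Σ; _×_; _,_; proj₁; proj₂)
open import Data.Product.Properties using (≡-dec)
open import Data.Sum using (_⊎_)
open import Data.List using (List; []; _∷_; length; filter; map)
open import Data.List.Membership.Propositional using (_∈_; _∉_)
open import Data.List.Relation.Unary.Unique.Propositional using (Unique)
open import Relation.Nullary using (¬_; yes; no; Dec)
open import Relation.Nullary.Decidable using (¬?)
open import Relation.Binary.PropositionalEquality using (_≡_; _≢_)
open import Function.Bundles using (_⇔_)
open import Data.Empty using (⊥)
open import Data.Unit using (⊤)

Arc : Set
Arc = ℕ × ℕ

_≟ᵃ_ : (a b : Arc) → Dec (a ≡ b)
_≟ᵃ_ = ≡-dec _≟_ _≟_

inArcs : List Arc → ℕ → List Arc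
inArcs A v = filter (λ a → proj₂ a ≟ v) A

outArcs : List Arc → ℕ → List Arc
outArcs A v = filter (λ a → proj₁ a ≟ v) A

indeg : List Arc → ℕ → ℕ
indeg A v = length (inArcs A v)

outdeg : List Arc → ℕ → ℕ
outdeg A v = length (outArcs A v)

parentsOf : List Arc → ℕ → List ℕ
parentsOf A v = map proj₁ (inArcs A v)

childrenOf : List Arc → ℕ → List ℕ
childrenOf A v = map proj₂ (outArcs A v)

data Reach⁺ (A : List Arc) : ℕ → ℕ → Set where
  one  : ∀ {u w} → (u , w) ∈ A → Reach⁺ A u w
  more : ∀ {u w z} → (u , w) ∈ A → Reach⁺ A w z → Reach⁺ A u z

record Network : Set where
  constructor mkNetwork
  field
    V    : List ℕ
    A    : List Arc
    X    : List ℕ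
    root : ℕ
open Network public

IsTreeVertex : Network → ℕ → Set
IsTreeVertex N v = indeg (A N) v ≡ 1 × outdeg (A N) v ≡ 2

IsReticulation : Network → ℕ → Set
IsReticulation N v = indeg (A N) v ≡ 2 × outdeg (A N) v ≡ 1

IsLeaf : Network → ℕ → Set
IsLeaf N v = v ∈ X N

record IsPhyloNetwork (N : Network) : Set where
  field
    X-nonempty   : X N ≢ []
    no-parallel  : Unique (A N)
    arcs-in-V    : ∀ {u w} → (u , w) ∈ A N → u ∈ V N × w ∈ V N
    acyclic      : ∀ v → ¬ Reach⁺ (A N) v v
    root-in-V    : root N ∈ V N
    root-indeg   : indeg (A N) (root N) ≡ 0
    root-outdeg  : outdeg (A N) (root N) ≡ 2
    leaves       : ∀ x → x ∈ X N →
                   x ∈ V N × indeg (A N) x ≡ 1 × outdeg (A N) x ≡ 0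
    others       : ∀ v → v ∈ V N → v ∉ X N →
                   v ≡ root N ⊎ IsTreeVertex N v ⊎ IsReticulation N v

TreeChild : Network → Set
TreeChild N = ∀ v → v ∈ V N → v ∉ X N →
  Σ ℕ λ c → (v , c) ∈ A N × (IsTreeVertex N c ⊎ IsLeaf N c)

data TreePath (N : Network) : ℕ → ℕ → Set where
  here : ∀ {a} → TreePath N a a
  step : ∀ {a c b} → (a , c) ∈ A N → (IsTreeVertex N c ⊎ IsLeaf N c) →
         TreePath N c b → TreePath N a b

removeIncident : ℕ → List Arc → List Arc
removeIncident x A = filter (λ a → ¬? (proj₁ a ≟ x)) (filter (λ a → ¬? (proj₂ a ≟ x)) A)

removeArc : Arc → List Arc → List Arc
removeArc e A = filter (λ a → ¬? (a ≟ᵃ e)) A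

removeVertex : ℕ → List ℕ → List ℕ
removeVertex x V = filter (λ y → ¬? (y ≟ x)) V

-- suppress a vertex x of in-degree 1 and out-degree 1: replace the arcs
-- (a , x), (x , b) by (a , b).  (Left unchanged if x does not have
-- in- and out-degree 1; this case never arises in the uses below.)
suppress : ℕ → List Arc → List Arc
suppress x A with parentsOf A x | childrenOf A x
... | a ∷ [] | b ∷ [] = (a , b) ∷ removeIncident x A
... | _      | _      = A

-- the other child of u (besides v); junk value u if there is none
otherChild : List Arc → ℕ → ℕ → ℕ
otherChild A u v with filter (λ c → ¬? (c ≟ v)) (childrenOf A u)
... | w ∷ _ = w
... | []    = u

_∖_ : Network → Arc → Network
N ∖ (u , v) with u ≟ root N
... | no _  = mkNetwork (removeVertex u (removeVertex v (V N)))
                        (suppress u (suppress v (removeArc (u , v) (A N))))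
                        (X N) (root N)
... | yes _ = mkNetwork (removeVertex u (removeVertex v (V N)))
                        (suppress v (removeIncident u (A N)))
                        (X N) (otherChild (A N) u v)

-- vertices: lf j = ℓ_j (0 ≤ j ≤ k), rv j = v_j, sp j = p_j, sq j = q_j
-- (1 ≤ j ≤ k)
data CV : Set where
  lf rv sp sq : ℕ → CV

InLadder : ℕ → CV → Set
InLadder k (lf j) = j ≤ k
InLadder k (rv j) = 1 ≤ j × j ≤ k
InLadder k (sp j) = 1 ≤ j × j ≤ k
InLadder k (sq j) = 1 ≤ j × j ≤ k

NonLeaf : CV → Set
NonLeaf (lf _) = ⊥
NonLeaf (rv _) = ⊤
NonLeaf (sp _) = ⊤
NonLeaf (sq _) = ⊤

-- spine arcs of ⟨ℓ₀, …, ℓₖ⟩: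
--   k = 1 : (q₁ , p₁)
--   k ≥ 2 : path qₖ, qₖ₋₁, pₖ, qₖ₋₂, pₖ₋₁, …, q₂, p₃, q₁, p₂, p₁, i.e. arcs
--           (qₖ , qₖ₋₁), (q_j , p_{j+1}) for 1 ≤ j ≤ k-1,
--           (p_{j+2} , q_j) for 1 ≤ j ≤ k-2, and (p₂ , p₁)
data SpineArc : ℕ → CV → CV → Set where
  s-one : SpineArc 1 (sq 1) (sp 1)
  s-top : ∀ {m} → SpineArc (suc (suc m)) (sq (suc (suc m))) (sq (suc m))
  s-qp  : ∀ {k j} → 2 ≤ k → 1 ≤ j → suc j ≤ k → SpineArc k (sq j) (sp (suc j))
  s-pq  : ∀ {k j} → 2 ≤ k → 1 ≤ j → suc (suc j) ≤ k → SpineArc k (sp (suc (suc j))) (sq j)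
  s-bot : ∀ {k} → 2 ≤ k → SpineArc k (sp 2) (sp 1)

record IsTCL (M : Network) (k : ℕ) (ℓ : ℕ → ℕ) (φ : CV → ℕ) : Set where
  field
    k≥1        : 1 ≤ k
    labels-distinct : ∀ i j → i ≤ k → j ≤ k → ℓ i ≡ ℓ j → i ≡ j
    labels-in-X : ∀ j → j ≤ k → ℓ j ∈ X M
    φ-vertex   : ∀ c → InLadder k c → φ c ∈ V M
    φ-injective : ∀ c d → InLadder k c → InLadder k d → φ c ≡ φ d → c ≡ d
    φ-leaf     : ∀ j → j ≤ k → φ (lf j) ≡ ℓ j
    P1-root    : TreePath M (φ (sp 1)) (ℓ 0)
    P1-rets    : ∀ j → 1 ≤ j → j ≤ k → TreePath M (φ (rv j)) (ℓ j)
    P2-p       : ∀ j → 1 ≤ j → j ≤ k → (φ (sp j) , φ (rv j)) ∈ A M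
    P2-q       : ∀ j → 1 ≤ j → j ≤ k → (φ (sq j) , φ (rv j)) ∈ A M
    P3         : ∀ c d → SpineArc k c d → (φ c , φ d) ∈ A M

record TCL (M : Network) : Set where
  constructor mkTCL
  field
    k     : ℕ
    ℓ     : ℕ → ℕ
    φ     : CV → ℕ
    isTCL : IsTCL M k ℓ φ
open TCL public

firstRung : ∀ {M} → TCL M → Arc
firstRung C = (φ C (sp 1) , φ C (rv 1))

lastRung : ∀ {M} → TCL M → Arc
lastRung C = (φ C (sq (k C)) , φ C (rv (k C)))

InCore : ∀ {M} → TCL M → ℕ → Set
InCore C x = Σ CV λ c → NonLeaf c × InLadder (k C) c × φ C c ≡ x

Equivalent : ∀ {M M'} → TCL M → TCL M' → Set
Equivalent C D = ∀ x → InCore C x ⇔ InCore D x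

{-# OPTIONS --safe #-}
-- Write e = (u , v), let w be the other parent of v, c the child of v and b the other child
-- of u.  Every arc of N ∖ e is an arc of N avoiding u and v, or (w , c), or (a , b) for the
-- parent a of u.  The rungs of C′ end in vertices with two parents, whose parent arcs
-- therefore survive from N.  A spine arc of C′ is never (w , c), as no child of w in N ∖ e is
-- a reticulation; that it is never (a , b) is the one place where e being the first or last
-- rung of C matters.  A pendant tree path of C′ lifts to N unless it uses (w , c), in which
-- case it lifts to a tree path ending at w, which is extended by the tree path from the spine
-- vertex w of C to ℓ₀.  Since tree vertices and leaves have a single parent, tree paths from
-- distinct pendant roots never meet, so the new leaf labels stay distinct and give a tight
-- caterpillar ladder of N with the same reticulations and spine as C′.

module Submission where

open import Defs
open import Data.Empty using (⊥; ⊥-elim)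
open import Data.Unit using (⊤; tt)
open import Data.Nat using (ℕ; zero; suc; _≤_; z≤n; s≤s; _≟_; _≤?_)
open import Data.Nat.Properties using (≤-refl; ≤-trans; n≤1+n; m≤n⇒m<n∨m≡n)
open import Data.Product using (Σ; _×_; _,_; proj₁; proj₂)
open import Data.Product.Properties using (,-injectiveˡ; ,-injectiveʳ)
open import Data.Sum using (_⊎_; inj₁; inj₂) renaming (map to map-⊎)
open import Data.List using (List; []; _∷_; length; map)
open import Data.List.Membership.Propositional using (_∈_; _∉_)
open import Data.List.Membership.Propositional.Properties using (∈-filter⁺; ∈-filter⁻)
open import Data.List.Membership.DecPropositional _≟_ using (_∈?_)
open import Data.List.Relation.Unary.Any using (here; there)
open import Data.List.Relation.Unary.All.Properties using (¬Any⇒All¬)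
open import Data.List.Relation.Unary.All using ([]; _∷_)
open import Data.List.Relation.Unary.AllPairs using ([]; _∷_)
open import Data.List.Relation.Unary.Unique.Propositional using (Unique)
open import Data.List.Relation.Unary.Unique.Propositional.Properties using (filter⁺)
open import Relation.Binary.Construct.Closure.ReflexiveTransitive using (Star; ε; _◅_; _◅◅_)
open import Relation.Binary.PropositionalEquality
  using (_≡_; _≢_; refl; sym; trans; cong; subst; subst₂; ≢-sym)
open import Relation.Nullary using (¬_; Dec; yes; no; contradiction)
open import Relation.Nullary.Decidable using (¬?)
open import Function.Base using (_∘_; id)
open import Function.Bundles using (_⇔_; mk⇔)

module _ {E : Set} where

  ∈⇒length≢0 : ∀ {x : E} {xs} → x ∈ xs → length xs ≢ 0
  ∈⇒length≢0 (here _)  ()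
  ∈⇒length≢0 (there _) ()

  length≡1⇒∃∈ : ∀ {xs : List E} → length xs ≡ 1 → Σ E (_∈ xs)
  length≡1⇒∃∈ {x ∷ []} _ = x , here refl

  length≡1⇒∈-unique : ∀ {x y : E} {xs} → length xs ≡ 1 → x ∈ xs → y ∈ xs → x ≡ y
  length≡1⇒∈-unique {xs = _ ∷ []} _ (here refl) (here refl) = refl
  length≡1⇒∈-unique {xs = _ ∷ []} _ (here _)    (there ())
  length≡1⇒∈-unique {xs = _ ∷ []} _ (there ())  _

  length≡2⇒∃≢∈ : ∀ {xs : List E} → Unique xs → length xs ≡ 2 →
                 Σ E λ x → Σ E λ y → x ∈ xs × y ∈ xs × x ≢ y
  length≡2⇒∃≢∈ {x ∷ y ∷ []} ((x≢y ∷ []) ∷ _) _ = x , y , here refl , there (here refl) , x≢y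

  ∈-pair : ∀ {x y z : E} → z ∈ x ∷ y ∷ [] → z ≡ x ⊎ z ≡ y
  ∈-pair (here z≡x)         = inj₁ z≡x
  ∈-pair (there (here z≡y)) = inj₂ z≡y

  length≡2⇒∈-one-of : ∀ {x y z : E} {xs} → length xs ≡ 2 → x ∈ xs → y ∈ xs → x ≢ y →
                      z ∈ xs → z ≡ x ⊎ z ≡ y
  length≡2⇒∈-one-of {xs = _ ∷ _ ∷ []} _ x∈ y∈ x≢y z∈
    with ∈-pair x∈ | ∈-pair y∈ | ∈-pair z∈
  ... | inj₁ refl | inj₁ refl | _         = contradiction refl x≢y
  ... | inj₂ refl | inj₂ refl | _         = contradiction refl x≢y
  ... | inj₁ refl | inj₂ refl | inj₁ refl = inj₁ refl
  ... | inj₁ refl | inj₂ refl | inj₂ refl = inj₂ refl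
  ... | inj₂ refl | inj₁ refl | inj₁ refl = inj₂ refl
  ... | inj₂ refl | inj₁ refl | inj₂ refl = inj₁ refl

  Unique-singleton : ∀ {x : E} {xs} → Unique xs → x ∈ xs → (∀ {y} → y ∈ xs → y ≡ x) → xs ≡ x ∷ []
  Unique-singleton {xs = y ∷ []} _ _ only-x = cong (_∷ []) (only-x (here refl))
  Unique-singleton {xs = y ∷ z ∷ _} ((y≢z ∷ _) ∷ _) _ only-x =
    contradiction (trans (only-x (here refl)) (sym (only-x (there (here refl))))) y≢z

module _ {L : List Arc} where

  ∈-inArcs⁺ : ∀ {p z} → (p , z) ∈ L → (p , z) ∈ inArcs L z
  ∈-inArcs⁺ pz = ∈-filter⁺ (λ a → proj₂ a ≟ _) pz refl

  ∈-outArcs⁺ : ∀ {z r} → (z , r) ∈ L → (z , r) ∈ outArcs L z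
  ∈-outArcs⁺ zr = ∈-filter⁺ (λ a → proj₁ a ≟ _) zr refl

  ∈-inArcs⁻ : ∀ {z e} → e ∈ inArcs L z → e ∈ L × proj₂ e ≡ z
  ∈-inArcs⁻ {z} = ∈-filter⁻ (λ a → proj₂ a ≟ z)

  ∈-outArcs⁻ : ∀ {z e} → e ∈ outArcs L z → e ∈ L × proj₁ e ≡ z
  ∈-outArcs⁻ {z} = ∈-filter⁻ (λ a → proj₁ a ≟ z)

  ∈-removeArc⁺ : ∀ {f e} → e ∈ L → e ≢ f → e ∈ removeArc f L
  ∈-removeArc⁺ {f} = ∈-filter⁺ (λ a → ¬? (a ≟ᵃ f))

  ∈-removeArc⁻ : ∀ {f e} → e ∈ removeArc f L → e ∈ L × e ≢ f
  ∈-removeArc⁻ {f} = ∈-filter⁻ (λ a → ¬? (a ≟ᵃ f))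

  ∈-removeIncident⁺ : ∀ {x e} → e ∈ L → proj₁ e ≢ x → proj₂ e ≢ x → e ∈ removeIncident x L
  ∈-removeIncident⁺ {x} e∈ e₁≢x e₂≢x =
    ∈-filter⁺ (λ a → ¬? (proj₁ a ≟ x)) (∈-filter⁺ (λ a → ¬? (proj₂ a ≟ x)) e∈ e₂≢x) e₁≢x

  ∈-removeIncident⁻ : ∀ {x e} → e ∈ removeIncident x L → e ∈ L × proj₁ e ≢ x × proj₂ e ≢ x
  ∈-removeIncident⁻ {x} e∈ with ∈-filter⁻ (λ a → ¬? (proj₁ a ≟ x)) e∈
  ... | e∈′ , e₁≢x with ∈-filter⁻ (λ a → ¬? (proj₂ a ≟ x)) e∈′
  ...   | e∈L , e₂≢x = e∈L , e₁≢x , e₂≢x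

  indeg≡1⇒parent-unique : ∀ {z p q} → indeg L z ≡ 1 → (p , z) ∈ L → (q , z) ∈ L → p ≡ q
  indeg≡1⇒parent-unique d pz qz = ,-injectiveˡ (length≡1⇒∈-unique d (∈-inArcs⁺ pz) (∈-inArcs⁺ qz))

  outdeg≡1⇒child-unique : ∀ {z r s} → outdeg L z ≡ 1 → (z , r) ∈ L → (z , s) ∈ L → r ≡ s
  outdeg≡1⇒child-unique d zr zs = ,-injectiveʳ (length≡1⇒∈-unique d (∈-outArcs⁺ zr) (∈-outArcs⁺ zs))

  indeg≡2⇒parent-one-of : ∀ {z p q r} → indeg L z ≡ 2 → (p , z) ∈ L → (q , z) ∈ L → p ≢ q →
                          (r , z) ∈ L → r ≡ p ⊎ r ≡ q
  indeg≡2⇒parent-one-of d pz qz p≢q rz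
    with length≡2⇒∈-one-of d (∈-inArcs⁺ pz) (∈-inArcs⁺ qz) (λ e → p≢q (,-injectiveˡ e)) (∈-inArcs⁺ rz)
  ... | inj₁ e = inj₁ (,-injectiveˡ e)
  ... | inj₂ e = inj₂ (,-injectiveˡ e)

  outdeg≡2⇒child-one-of : ∀ {z r s t} → outdeg L z ≡ 2 → (z , r) ∈ L → (z , s) ∈ L → r ≢ s →
                          (z , t) ∈ L → t ≡ r ⊎ t ≡ s
  outdeg≡2⇒child-one-of d zr zs r≢s zt
    with length≡2⇒∈-one-of d (∈-outArcs⁺ zr) (∈-outArcs⁺ zs) (λ e → r≢s (,-injectiveʳ e)) (∈-outArcs⁺ zt)
  ... | inj₁ e = inj₁ (,-injectiveʳ e)
  ... | inj₂ e = inj₂ (,-injectiveʳ e)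

  parentsOf-singleton : ∀ {z p} → Unique L → (p , z) ∈ L → (∀ {q} → (q , z) ∈ L → q ≡ p) →
                  parentsOf L z ≡ p ∷ []
  parentsOf-singleton {z} uniq pz only-p =
    cong (map proj₁) (Unique-singleton (filter⁺ (λ a → proj₂ a ≟ z) uniq) (∈-inArcs⁺ pz) only)
    where
    only : ∀ {e} → e ∈ inArcs L z → e ≡ (_ , z)
    only e∈ with ∈-inArcs⁻ e∈
    ... | qz , refl = cong (_, z) (only-p qz)

  childrenOf-singleton : ∀ {z r} → Unique L → (z , r) ∈ L → (∀ {s} → (z , s) ∈ L → s ≡ r) →
                   childrenOf L z ≡ r ∷ []
  childrenOf-singleton {z} uniq zr only-r =
    cong (map proj₂) (Unique-singleton (filter⁺ (λ a → proj₁ a ≟ z) uniq) (∈-outArcs⁺ zr) only)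
    where
    only : ∀ {e} → e ∈ outArcs L z → e ≡ (z , _)
    only e∈ with ∈-outArcs⁻ e∈
    ... | zs , refl = cong (z ,_) (only-r zs)

suppress-≡ : ∀ L {x a b} → parentsOf L x ≡ a ∷ [] → childrenOf L x ≡ b ∷ [] →
             suppress x L ≡ (a , b) ∷ removeIncident x L
suppress-≡ L {x} ps cs rewrite ps | cs = refl

removeArc-Unique : ∀ {f L} → Unique L → Unique (removeArc f L)
removeArc-Unique {f} = filter⁺ (λ a → ¬? (a ≟ᵃ f))

removeIncident-Unique : ∀ {x L} → Unique L → Unique (removeIncident x L)
removeIncident-Unique {x} u = filter⁺ (λ a → ¬? (proj₁ a ≟ x)) (filter⁺ (λ a → ¬? (proj₂ a ≟ x)) u)

∷-Unique : ∀ {e : Arc} {L} → e ∉ L → Unique L → Unique (e ∷ L)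
∷-Unique {L = L} e∉ u = ¬Any⇒All¬ L e∉ ∷ u

∖-arcs : ∀ N u v →
  (u ≢ root N × A (N ∖ (u , v)) ≡ suppress u (suppress v (removeArc (u , v) (A N))))
  ⊎ (u ≡ root N × A (N ∖ (u , v)) ≡ suppress v (removeIncident u (A N)))
∖-arcs N u v with u ≟ root N
... | no u≢r  = inj₁ (u≢r , refl)
... | yes u≡r = inj₂ (u≡r , refl)

∖-leaves : ∀ N u v → X (N ∖ (u , v)) ≡ X N
∖-leaves N u v with u ≟ root N
... | no _  = refl
... | yes _ = refl

∖-vertices⊆ : ∀ N u v {x} → x ∈ V (N ∖ (u , v)) → x ∈ V N
∖-vertices⊆ N u v x∈ with u ≟ root N
... | no _  = proj₁ (∈-filter⁻ (λ y → ¬? (y ≟ v)) (proj₁ (∈-filter⁻ (λ y → ¬? (y ≟ u)) x∈)))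
... | yes _ = proj₁ (∈-filter⁻ (λ y → ¬? (y ≟ v)) (proj₁ (∈-filter⁻ (λ y → ¬? (y ≟ u)) x∈)))

HasTwoParents : Network → ℕ → Set
HasTwoParents M z = Σ ℕ λ p → Σ ℕ λ q → (p , z) ∈ A M × (q , z) ∈ A M × p ≢ q

TreeOrLeaf : Network → ℕ → Set
TreeOrLeaf M z = IsTreeVertex M z ⊎ IsLeaf M z

treeVertex⇒¬HasTwoParents : ∀ {M z} → IsTreeVertex M z → ¬ HasTwoParents M z
treeVertex⇒¬HasTwoParents (d , _) (_ , _ , pz , qz , p≢q) = p≢q (indeg≡1⇒parent-unique d pz qz)

Reach* : List Arc → ℕ → ℕ → Set
Reach* L x y = x ≡ y ⊎ Reach⁺ L x y

module _ {L : List Arc} where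

  _++⁺_ : ∀ {x y z} → Reach⁺ L x y → Reach⁺ L y z → Reach⁺ L x z
  one xy    ++⁺ r = more xy r
  more xy q ++⁺ r = more xy (q ++⁺ r)

  _*++⁺_ : ∀ {x y z} → Reach* L x y → Reach⁺ L y z → Reach⁺ L x z
  inj₁ refl *++⁺ r = r
  inj₂ q    *++⁺ r = q ++⁺ r

  _⁺++*_ : ∀ {x y z} → Reach⁺ L x y → Reach* L y z → Reach⁺ L x z
  q ⁺++* inj₁ refl = q
  q ⁺++* inj₂ r    = q ++⁺ r

data Walk (L : List Arc) (Q : ℕ → Set) : ℕ → ℕ → Set where
  wnil  : ∀ {a} → Walk L Q a a
  wcons : ∀ {a c b} → (a , c) ∈ L → Q c → Walk L Q c b → Walk L Q a b

walk-end : ∀ {L Q r s} → Walk L Q r s → r ≡ s ⊎ Q s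
walk-end wnil = inj₁ refl
walk-end (wcons _ q w) with walk-end w
... | inj₁ refl = inj₂ q
... | inj₂ q′   = inj₂ q′

module _ {N : Network} where

  treePath⇒walk : ∀ {x y} → TreePath N x y → Walk (A N) (TreeOrLeaf N) x y
  treePath⇒walk here         = wnil
  treePath⇒walk (step a t p) = wcons a t (treePath⇒walk p)

  walk⇒treePath : ∀ {x y} → Walk (A N) (TreeOrLeaf N) x y → TreePath N x y
  walk⇒treePath wnil          = here
  walk⇒treePath (wcons a t w) = step a t (walk⇒treePath w)

  _++ᵗ_ : ∀ {x y z} → TreePath N x y → TreePath N y z → TreePath N x z
  here       ++ᵗ q = q
  step a t p ++ᵗ q = step a t (p ++ᵗ q)

  treePath⇒Reach* : ∀ {x y} → TreePath N x y → Reach* (A N) x y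
  treePath⇒Reach* here         = inj₁ refl
  treePath⇒Reach* (step a _ p) = inj₂ (one a ⁺++* treePath⇒Reach* p)

  treePath-end : ∀ {x y} → TreePath N x y → x ≡ y ⊎ TreeOrLeaf N y
  treePath-end p = walk-end (treePath⇒walk p)

  treePath-lastArc : ∀ {x z} → TreePath N x z →
                     x ≡ z ⊎ Σ ℕ λ y → TreePath N x y × (y , z) ∈ A N × TreeOrLeaf N z
  treePath-lastArc here = inj₁ refl
  treePath-lastArc (step a t p) with treePath-lastArc p
  ... | inj₁ refl               = inj₂ (_ , here , a , t)
  ... | inj₂ (y , p′ , yz , tz) = inj₂ (y , step a t p′ , yz , tz)

module TreeChildNetwork {N : Network} (ph : IsPhyloNetwork N) (tc : TreeChild N) where
  open IsPhyloNetwork ph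

  tail∈V : ∀ {x y} → (x , y) ∈ A N → x ∈ V N
  tail∈V xy = proj₁ (arcs-in-V xy)

  head∈V : ∀ {x y} → (x , y) ∈ A N → y ∈ V N
  head∈V xy = proj₂ (arcs-in-V xy)

  root-parentless : ∀ {p} → (p , root N) ∉ A N
  root-parentless pr = ∈⇒length≢0 (∈-inArcs⁺ pr) root-indeg

  tail∉X : ∀ {z r} → (z , r) ∈ A N → z ∉ X N
  tail∉X zr z∈X = ∈⇒length≢0 (∈-outArcs⁺ zr) (proj₂ (proj₂ (leaves _ z∈X)))

  treeOrLeaf⇒indeg≡1 : ∀ {z} → TreeOrLeaf N z → indeg (A N) z ≡ 1
  treeOrLeaf⇒indeg≡1 (inj₁ t) = proj₁ t
  treeOrLeaf⇒indeg≡1 (inj₂ l) = proj₁ (proj₂ (leaves _ l))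

  treeOrLeaf-parent-unique : ∀ {z p q} → TreeOrLeaf N z → (p , z) ∈ A N → (q , z) ∈ A N → p ≡ q
  treeOrLeaf-parent-unique t = indeg≡1⇒parent-unique (treeOrLeaf⇒indeg≡1 t)

  treeOrLeaf⇒¬HasTwoParents : ∀ {z} → TreeOrLeaf N z → ¬ HasTwoParents N z
  treeOrLeaf⇒¬HasTwoParents t (_ , _ , pz , qz , p≢q) = p≢q (treeOrLeaf-parent-unique t pz qz)

  HasTwoParents⇒∉X : ∀ {z} → HasTwoParents N z → z ∉ X N
  HasTwoParents⇒∉X two z∈X = treeOrLeaf⇒¬HasTwoParents (inj₂ z∈X) two

  HasTwoParents⇒reticulation : ∀ {z} → HasTwoParents N z → IsReticulation N z
  HasTwoParents⇒reticulation two@(_ , _ , pz , _ , _) with others _ (head∈V pz) (HasTwoParents⇒∉X two)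
  ... | inj₁ refl        = contradiction pz root-parentless
  ... | inj₂ (inj₁ t)    = contradiction two (treeOrLeaf⇒¬HasTwoParents (inj₁ t))
  ... | inj₂ (inj₂ ret)  = ret

  HasTwoParents-parent-one-of : ∀ {z p q r} → (p , z) ∈ A N → (q , z) ∈ A N → p ≢ q →
                                (r , z) ∈ A N → r ≡ p ⊎ r ≡ q
  HasTwoParents-parent-one-of pz qz p≢q =
    indeg≡2⇒parent-one-of (proj₁ (HasTwoParents⇒reticulation (_ , _ , pz , qz , p≢q))) pz qz p≢q

  reticulation-child-unique : ∀ {z r s} → HasTwoParents N z → (z , r) ∈ A N → (z , s) ∈ A N → r ≡ s
  reticulation-child-unique two = outdeg≡1⇒child-unique (proj₂ (HasTwoParents⇒reticulation two))

  reticulation-child-treeOrLeaf : ∀ {z r} → HasTwoParents N z → (z , r) ∈ A N → TreeOrLeaf N r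
  reticulation-child-treeOrLeaf two zr with tc _ (tail∈V zr) (HasTwoParents⇒∉X two)
  ... | _ , zs , ts = subst (TreeOrLeaf N) (reticulation-child-unique two zs zr) ts

  twoChildren⇒root⊎treeVertex : ∀ {z x y} → (z , x) ∈ A N → (z , y) ∈ A N → x ≢ y →
                                z ≡ root N ⊎ IsTreeVertex N z
  twoChildren⇒root⊎treeVertex zx zy x≢y with others _ (tail∈V zx) (tail∉X zx)
  ... | inj₁ z≡r        = inj₁ z≡r
  ... | inj₂ (inj₁ t)   = inj₂ t
  ... | inj₂ (inj₂ ret) = contradiction (outdeg≡1⇒child-unique (proj₂ ret) zx zy) x≢y

  twoChildren-child-one-of : ∀ {z x y r} → (z , x) ∈ A N → (z , y) ∈ A N → x ≢ y →
                             (z , r) ∈ A N → r ≡ x ⊎ r ≡ y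
  twoChildren-child-one-of zx zy x≢y = outdeg≡2⇒child-one-of outdeg≡2 zx zy x≢y
    where
    outdeg≡2 : outdeg (A N) _ ≡ 2
    outdeg≡2 with twoChildren⇒root⊎treeVertex zx zy x≢y
    ... | inj₁ refl = root-outdeg
    ... | inj₂ t    = proj₂ t

  parent-twoChildren⇒treeVertex : ∀ {p z x y} → (p , z) ∈ A N → (z , x) ∈ A N → (z , y) ∈ A N →
                                  x ≢ y → IsTreeVertex N z
  parent-twoChildren⇒treeVertex pz zx zy x≢y with twoChildren⇒root⊎treeVertex zx zy x≢y
  ... | inj₁ refl = contradiction pz root-parentless
  ... | inj₂ t    = t

  twoChildren-parent-unique : ∀ {z x y p q} → (z , x) ∈ A N → (z , y) ∈ A N → x ≢ y →
                              (p , z) ∈ A N → (q , z) ∈ A N → p ≡ q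
  twoChildren-parent-unique zx zy x≢y pz =
    treeOrLeaf-parent-unique (inj₁ (parent-twoChildren⇒treeVertex pz zx zy x≢y)) pz

  nonroot-twoChildren⇒parent : ∀ {z x y} → (z , x) ∈ A N → (z , y) ∈ A N → x ≢ y → z ≢ root N →
                               Σ ℕ λ p → (p , z) ∈ A N
  nonroot-twoChildren⇒parent {z} zx zy x≢y z≢r with twoChildren⇒root⊎treeVertex zx zy x≢y
  ... | inj₁ z≡r = contradiction z≡r z≢r
  ... | inj₂ t with length≡1⇒∃∈ (proj₁ t)
  ...   | _ , e∈ with ∈-inArcs⁻ {z = z} e∈
  ...     | pz , refl = _ , pz

  parent⇒treeOrLeaf⊎HasTwoParents : ∀ {p z} → (p , z) ∈ A N → TreeOrLeaf N z ⊎ HasTwoParents N z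
  parent⇒treeOrLeaf⊎HasTwoParents {z = z} pz with z ∈? X N
  ... | yes z∈X = inj₁ (inj₂ z∈X)
  ... | no z∉X with others z (head∈V pz) z∉X
  ...   | inj₁ refl     = contradiction pz root-parentless
  ...   | inj₂ (inj₁ t) = inj₁ (inj₁ t)
  ...   | inj₂ (inj₂ ret) with length≡2⇒∃≢∈ (filter⁺ (λ a → proj₂ a ≟ z) no-parallel) (proj₁ ret)
  ...     | _ , _ , e∈ , f∈ , e≢f with ∈-inArcs⁻ {z = z} e∈ | ∈-inArcs⁻ {z = z} f∈
  ...       | qz , refl | rz , refl = inj₂ (_ , _ , qz , rz , λ q≡r → e≢f (cong (_, z) q≡r))

  reticulationParent-treeOrLeaf : ∀ {p z r x} → (p , z) ∈ A N → (z , r) ∈ A N → HasTwoParents N r →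
                                  TreePath N z x → x ∈ X N → TreeOrLeaf N z
  reticulationParent-treeOrLeaf _ _ _ here x∈X = inj₂ x∈X
  reticulationParent-treeOrLeaf {r = r} pz zr two (step {c = y} zy ty _) _ =
    inj₁ (parent-twoChildren⇒treeVertex pz zr zy r≢y)
    where
    r≢y : r ≢ y
    r≢y refl = treeOrLeaf⇒¬HasTwoParents ty two

  treePath-first-arc : ∀ {z r x} → (z , r) ∈ A N → TreePath N z x → x ∈ X N →
                       Σ ℕ λ y → (z , y) ∈ A N × TreeOrLeaf N y
  treePath-first-arc zr here x∈X         = contradiction x∈X (tail∉X zr)
  treePath-first-arc _  (step zy t _) _ = _ , zy , t

  treePath-walk-comparable : ∀ {Q s z r} → TreePath N s z → Walk (A N) Q r z →
                             Walk (A N) Q r s ⊎ TreePath N s r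
  treePath-walk-comparable p wnil = inj₂ p
  treePath-walk-comparable p (wcons ra q w) with treePath-walk-comparable p w
  ... | inj₁ w′ = inj₁ (wcons ra q w′)
  ... | inj₂ p′ with treePath-lastArc p′
  ...   | inj₁ refl = inj₁ (wcons ra q wnil)
  ...   | inj₂ (_ , p″ , ya , ta) = inj₂ (subst (TreePath N _) (treeOrLeaf-parent-unique ta ya ra) p″)

  treePaths-comparable : ∀ {s r z} → TreePath N s z → TreePath N r z →
                         TreePath N r s ⊎ TreePath N s r
  treePaths-comparable p q with treePath-walk-comparable p (treePath⇒walk q)
  ... | inj₁ w = inj₁ (walk⇒treePath w)
  ... | inj₂ t = inj₂ t

module ArcDeletion {N : Network} (ph : IsPhyloNetwork N) (tc : TreeChild N)
                   {u v w b : ℕ} (uv : (u , v) ∈ A N) (wv : (w , v) ∈ A N) (u≢w : u ≢ w)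
                   (ub : (u , b) ∈ A N) (b≢v : b ≢ v) where
  open IsPhyloNetwork ph using (acyclic; no-parallel)
  open TreeChildNetwork ph tc

  N′ : Network
  N′ = N ∖ (u , v)

  v-twoParents : HasTwoParents N v
  v-twoParents = u , w , uv , wv , u≢w

  private
    v-child : Σ ℕ λ c → (v , c) ∈ A N × TreeOrLeaf N c
    v-child = tc v (head∈V uv) (HasTwoParents⇒∉X v-twoParents)

  c : ℕ
  c = proj₁ v-child

  vc : (v , c) ∈ A N
  vc = proj₁ (proj₂ v-child)

  c-treeOrLeaf : TreeOrLeaf N c
  c-treeOrLeaf = reticulation-child-treeOrLeaf v-twoParents vc

  v-parent-one-of : ∀ {p} → (p , v) ∈ A N → p ≡ u ⊎ p ≡ w
  v-parent-one-of = HasTwoParents-parent-one-of uv wv u≢w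

  v-child-unique : ∀ {r} → (v , r) ∈ A N → r ≡ c
  v-child-unique vr = reticulation-child-unique v-twoParents vr vc

  u-child-one-of : ∀ {r} → (u , r) ∈ A N → r ≡ v ⊎ r ≡ b
  u-child-one-of = twoChildren-child-one-of uv ub (≢-sym b≢v)

  u-parent-unique : ∀ {p q} → (p , u) ∈ A N → (q , u) ∈ A N → p ≡ q
  u-parent-unique = twoChildren-parent-unique uv ub (≢-sym b≢v)

  u-treeVertex : ∀ {a} → (a , u) ∈ A N → IsTreeVertex N u
  u-treeVertex au = parent-twoChildren⇒treeVertex au uv ub (≢-sym b≢v)

  b-treeOrLeaf : TreeOrLeaf N b
  b-treeOrLeaf with tc u (tail∈V uv) (tail∉X uv)
  ... | _ , uy , ty with u-child-one-of uy
  ...   | inj₁ refl = contradiction v-twoParents (treeOrLeaf⇒¬HasTwoParents ty)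
  ...   | inj₂ refl = ty

  private
    w-treeChild : Σ ℕ λ t → (w , t) ∈ A N × TreeOrLeaf N t
    w-treeChild = tc w (tail∈V wv) (tail∉X wv)

    v≢w-treeChild : v ≢ proj₁ w-treeChild
    v≢w-treeChild v≡t =
      treeOrLeaf⇒¬HasTwoParents (subst (TreeOrLeaf N) (sym v≡t) (proj₂ (proj₂ w-treeChild))) v-twoParents

  w-child-treeOrLeaf : ∀ {r} → (w , r) ∈ A N → r ≢ v → TreeOrLeaf N r
  w-child-treeOrLeaf wr r≢v with twoChildren-child-one-of wv (proj₁ (proj₂ w-treeChild)) v≢w-treeChild wr
  ... | inj₁ r≡v = contradiction r≡v r≢v
  ... | inj₂ r≡t = subst (TreeOrLeaf N) (sym r≡t) (proj₂ (proj₂ w-treeChild))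

  w-¬HasTwoParents : ¬ HasTwoParents N w
  w-¬HasTwoParents two@(_ , _ , pw , _ , _) =
    treeVertex⇒¬HasTwoParents {N}
      (parent-twoChildren⇒treeVertex pw wv (proj₁ (proj₂ w-treeChild)) v≢w-treeChild) two

  u≢v : u ≢ v
  u≢v refl = acyclic _ (one uv)

  c≢v : c ≢ v
  c≢v c≡v = acyclic v (subst (Reach⁺ (A N) v) c≡v (one vc))

  c≢u : c ≢ u
  c≢u c≡u = acyclic u (more uv (subst (Reach⁺ (A N) v) c≡u (one vc)))

  b≢u : b ≢ u
  b≢u refl = acyclic _ (one ub)

  b≢c : b ≢ c
  b≢c b≡c = treeOrLeaf⇒¬HasTwoParents c-treeOrLeaf (u , v , subst (λ z → (u , z) ∈ A N) b≡c ub , vc , u≢v)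

  wc∉A : (w , c) ∉ A N
  wc∉A wc = treeOrLeaf⇒¬HasTwoParents c-treeOrLeaf (w , v , wc , vc , λ { refl → acyclic _ (one wv) })

  private
    A₁ : List Arc
    A₁ = removeArc (u , v) (A N)

    A₂ : List Arc
    A₂ = (w , c) ∷ removeIncident v A₁

    B₁ : List Arc
    B₁ = removeIncident u (A N)

    A₁-Unique : Unique A₁
    A₁-Unique = removeArc-Unique no-parallel

    A₂-Unique : Unique A₂
    A₂-Unique = ∷-Unique (λ wc∈ → wc∉A (proj₁ (∈-removeArc⁻ (proj₁ (∈-removeIncident⁻ wc∈)))))
                         (removeIncident-Unique A₁-Unique)

    suppress-v-A₁ : suppress v A₁ ≡ A₂
    suppress-v-A₁ = suppress-≡ A₁ (parentsOf-singleton {L = A₁} A₁-Unique wv∈ only-w)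
                                  (childrenOf-singleton {L = A₁} A₁-Unique vc∈ only-c)
      where
      wv∈ : (w , v) ∈ A₁
      wv∈ = ∈-removeArc⁺ wv (λ e → u≢w (sym (,-injectiveˡ e)))
      only-w : ∀ {q} → (q , v) ∈ A₁ → q ≡ w
      only-w qv with ∈-removeArc⁻ qv
      ... | qv′ , qv≢uv with v-parent-one-of qv′
      ...   | inj₁ refl = contradiction refl qv≢uv
      ...   | inj₂ q≡w  = q≡w
      vc∈ : (v , c) ∈ A₁
      vc∈ = ∈-removeArc⁺ vc (λ e → u≢v (sym (,-injectiveˡ e)))
      only-c : ∀ {s} → (v , s) ∈ A₁ → s ≡ c
      only-c vs = v-child-unique (proj₁ (∈-removeArc⁻ vs))

    suppress-u-A₂ : ∀ {a} → (a , u) ∈ A N → suppress u A₂ ≡ (a , b) ∷ removeIncident u A₂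
    suppress-u-A₂ {a} au = suppress-≡ A₂ (parentsOf-singleton {L = A₂} A₂-Unique au∈ only-a)
                                         (childrenOf-singleton {L = A₂} A₂-Unique ub∈ only-b)
      where
      a≢u : a ≢ u
      a≢u refl = acyclic _ (one au)
      a≢v : a ≢ v
      a≢v refl = acyclic _ (more au (one uv))
      au∈ : (a , u) ∈ A₂
      au∈ = there (∈-removeIncident⁺ (∈-removeArc⁺ au (λ e → a≢u (,-injectiveˡ e))) a≢v u≢v)
      only-a : ∀ {q} → (q , u) ∈ A₂ → q ≡ a
      only-a (here e)   = contradiction (sym (,-injectiveʳ e)) c≢u
      only-a (there qu) = u-parent-unique (proj₁ (∈-removeArc⁻ (proj₁ (∈-removeIncident⁻ qu)))) au
      ub∈ : (u , b) ∈ A₂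
      ub∈ = there (∈-removeIncident⁺ (∈-removeArc⁺ ub (λ e → b≢v (,-injectiveʳ e))) u≢v b≢v)
      only-b : ∀ {s} → (u , s) ∈ A₂ → s ≡ b
      only-b (here e) = contradiction (,-injectiveˡ e) u≢w
      only-b (there us) with ∈-removeArc⁻ (proj₁ (∈-removeIncident⁻ us))
      ... | us′ , us≢uv with u-child-one-of us′
      ...   | inj₁ refl = contradiction refl us≢uv
      ...   | inj₂ s≡b  = s≡b

    suppress-v-B₁ : suppress v B₁ ≡ (w , c) ∷ removeIncident v B₁
    suppress-v-B₁ = suppress-≡ B₁ (parentsOf-singleton {L = B₁} B₁-Unique wv∈ only-w)
                                  (childrenOf-singleton {L = B₁} B₁-Unique vc∈ only-c)
      where
      B₁-Unique : Unique B₁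
      B₁-Unique = removeIncident-Unique no-parallel
      wv∈ : (w , v) ∈ B₁
      wv∈ = ∈-removeIncident⁺ wv (≢-sym u≢w) (≢-sym u≢v)
      only-w : ∀ {q} → (q , v) ∈ B₁ → q ≡ w
      only-w qv with ∈-removeIncident⁻ qv
      ... | qv′ , q≢u , _ with v-parent-one-of qv′
      ...   | inj₁ q≡u = contradiction q≡u q≢u
      ...   | inj₂ q≡w = q≡w
      vc∈ : (v , c) ∈ B₁
      vc∈ = ∈-removeIncident⁺ vc (≢-sym u≢v) c≢u
      only-c : ∀ {s} → (v , s) ∈ B₁ → s ≡ c
      only-c vs = v-child-unique (proj₁ (∈-removeIncident⁻ vs))

    arcs-N′ : (Σ ℕ λ a → (a , u) ∈ A N × A N′ ≡ (a , b) ∷ removeIncident u A₂)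
              ⊎ A N′ ≡ (w , c) ∷ removeIncident v B₁
    arcs-N′ with ∖-arcs N u v
    ... | inj₂ (_ , eq) = inj₂ (trans eq suppress-v-B₁)
    ... | inj₁ (u≢r , eq) with nonroot-twoChildren⇒parent uv ub (≢-sym b≢v) u≢r
    ...   | a , au = inj₁ (a , au , trans eq (trans (cong (suppress u) suppress-v-A₁) (suppress-u-A₂ au)))

  -- via-u is the arc (a , b) created by suppressing u, via-v the arc (w , c) from suppressing v.
  data Residual (x y : ℕ) : Set where
    via-u : (x , u) ∈ A N → y ≡ b → Residual x y
    via-v : x ≡ w → y ≡ c → Residual x y
    kept  : (x , y) ∈ A N → x ≢ u → x ≢ v → y ≢ u → y ≢ v → Residual x y

  residual : ∀ {x y} → (x , y) ∈ A N′ → Residual x y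
  residual {x} {y} xy with arcs-N′
  ... | inj₁ (a , au , eq) = nonroot (subst ((x , y) ∈_) eq xy)
    where
    nonroot : (x , y) ∈ (a , b) ∷ removeIncident u A₂ → Residual x y
    nonroot (here refl) = via-u au refl
    nonroot (there xy′) with ∈-removeIncident⁻ {L = A₂} xy′
    ... | here refl , _ , _ = via-v refl refl
    ... | there xy″ , x≢u , y≢u with ∈-removeIncident⁻ {L = A₁} xy″
    ...   | xy‴ , x≢v , y≢v = kept (proj₁ (∈-removeArc⁻ xy‴)) x≢u x≢v y≢u y≢v
  ... | inj₂ eq = rooted (subst ((x , y) ∈_) eq xy)
    where
    rooted : (x , y) ∈ (w , c) ∷ removeIncident v B₁ → Residual x y
    rooted (here refl) = via-v refl refl
    rooted (there xy′) with ∈-removeIncident⁻ {L = B₁} xy′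
    ... | xy″ , x≢v , y≢v with ∈-removeIncident⁻ {L = A N} xy″
    ...   | xy‴ , x≢u , y≢u = kept xy‴ x≢u x≢v y≢u y≢v

  kept-arc : ∀ {x y} → (x , y) ∈ A N → x ≢ u → x ≢ v → y ≢ u → y ≢ v → (x , y) ∈ A N′
  kept-arc {x} {y} xy x≢u x≢v y≢u y≢v with arcs-N′
  ... | inj₁ (_ , _ , eq) =
    subst ((x , y) ∈_) (sym eq)
      (there (∈-removeIncident⁺ {L = A₂}
               (there (∈-removeIncident⁺ {L = A₁} (∈-removeArc⁺ xy (x≢u ∘ ,-injectiveˡ)) x≢v y≢v))
               x≢u y≢u))
  ... | inj₂ eq =
    subst ((x , y) ∈_) (sym eq) (there (∈-removeIncident⁺ {L = B₁} (∈-removeIncident⁺ xy x≢u y≢u) x≢v y≢v))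

  X′≡X : X N′ ≡ X N
  X′≡X = ∖-leaves N u v

  V′⊆V : ∀ {x} → x ∈ V N′ → x ∈ V N
  V′⊆V = ∖-vertices⊆ N u v

  arc′⇒Reach⁺ : ∀ {x y} → (x , y) ∈ A N′ → Reach⁺ (A N) x y
  arc′⇒Reach⁺ xy with residual xy
  ... | via-u au refl   = more au (one ub)
  ... | via-v refl refl = more wv (one vc)
  ... | kept xy′ _ _ _ _ = one xy′

  head′-parent : ∀ {x y} → (x , y) ∈ A N′ → Σ ℕ λ p → (p , y) ∈ A N
  head′-parent xy with residual xy
  ... | via-u _ refl     = u , ub
  ... | via-v _ refl     = v , vc
  ... | kept xy′ _ _ _ _ = _ , xy′

  head′-≢u : ∀ {x y} → (x , y) ∈ A N′ → y ≢ u
  head′-≢u xy with residual xy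
  ... | via-u _ refl       = b≢u
  ... | via-v _ refl       = c≢u
  ... | kept _ _ _ y≢u _   = y≢u

  head′-≢v : ∀ {x y} → (x , y) ∈ A N′ → y ≢ v
  head′-≢v xy with residual xy
  ... | via-u _ refl       = b≢v
  ... | via-v _ refl       = c≢v
  ... | kept _ _ _ _ y≢v   = y≢v

  HasTwoParents′⇒parent-arc : ∀ {p q z} → (p , z) ∈ A N′ → (q , z) ∈ A N′ → p ≢ q → (p , z) ∈ A N
  HasTwoParents′⇒parent-arc pz qz p≢q with residual pz | residual qz
  ... | kept pz′ _ _ _ _ | _                  = pz′
  ... | via-u au refl    | via-u au′ _        = contradiction (u-parent-unique au au′) p≢q
  ... | via-u _ refl     | via-v _ b≡c        = contradiction b≡c b≢c
  ... | via-u _ refl     | kept qb q≢u _ _ _  =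
    contradiction (treeOrLeaf-parent-unique b-treeOrLeaf qb ub) q≢u
  ... | via-v refl refl  | via-u _ c≡b        = contradiction (sym c≡b) b≢c
  ... | via-v refl refl  | via-v q≡w _        = contradiction (sym q≡w) p≢q
  ... | via-v refl refl  | kept qc _ q≢v _ _  =
    contradiction (treeOrLeaf-parent-unique c-treeOrLeaf qc vc) q≢v

  HasTwoParents-lift : ∀ {z} → HasTwoParents N′ z → HasTwoParents N z
  HasTwoParents-lift (p , q , pz , qz , p≢q) =
    p , q , HasTwoParents′⇒parent-arc pz qz p≢q , HasTwoParents′⇒parent-arc qz pz (≢-sym p≢q) , p≢q

  HasTwoParents-lower : ∀ {z} → HasTwoParents N z → z ≢ u → z ≢ v → HasTwoParents N′ z
  HasTwoParents-lower {z} two@(p , q , pz , qz , p≢q) z≢u z≢v = p , q , keep pz , keep qz , p≢q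
    where
    keep : ∀ {r} → (r , z) ∈ A N → (r , z) ∈ A N′
    keep {r} rz = kept-arc rz r≢u r≢v z≢u z≢v
      where
      r≢u : r ≢ u
      r≢u refl with u-child-one-of rz
      ... | inj₁ z≡v = z≢v z≡v
      ... | inj₂ refl = treeOrLeaf⇒¬HasTwoParents b-treeOrLeaf two
      r≢v : r ≢ v
      r≢v refl = treeOrLeaf⇒¬HasTwoParents (subst (TreeOrLeaf N) (sym (v-child-unique rz)) c-treeOrLeaf) two

  treeOrLeaf-lift : ∀ {x y} → (x , y) ∈ A N′ → TreeOrLeaf N′ y → TreeOrLeaf N y
  treeOrLeaf-lift _  (inj₂ y∈X′) = inj₂ (subst (_ ∈_) X′≡X y∈X′)
  treeOrLeaf-lift xy (inj₁ t′) with parent⇒treeOrLeaf⊎HasTwoParents (proj₂ (head′-parent xy))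
  ... | inj₁ t   = t
  ... | inj₂ two =
    contradiction (HasTwoParents-lower two (head′-≢u xy) (head′-≢v xy)) (treeVertex⇒¬HasTwoParents {N′} t′)

  treePath-lift : ∀ {x z} → TreePath N′ x z → TreePath N x z ⊎ TreePath N x w
  treePath-lift here = inj₁ here
  treePath-lift (step xy t p) with residual xy
  ... | via-u au refl    = map-⊎ (step au (inj₁ (u-treeVertex au)) ∘ step ub b-treeOrLeaf)
                                 (step au (inj₁ (u-treeVertex au)) ∘ step ub b-treeOrLeaf) (treePath-lift p)
  ... | via-v refl _     = inj₂ here
  ... | kept xy′ _ _ _ _ =
    map-⊎ (step xy′ (treeOrLeaf-lift xy t)) (step xy′ (treeOrLeaf-lift xy t)) (treePath-lift p)

  w-child′-¬HasTwoParents : ∀ {r} → (w , r) ∈ A N′ → ¬ HasTwoParents N′ r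
  w-child′-¬HasTwoParents wr two′ with residual wr
  ... | via-u _ refl = treeOrLeaf⇒¬HasTwoParents b-treeOrLeaf (HasTwoParents-lift two′)
  ... | via-v _ refl = treeOrLeaf⇒¬HasTwoParents c-treeOrLeaf (HasTwoParents-lift two′)
  ... | kept wr′ _ _ _ r≢v =
    treeOrLeaf⇒¬HasTwoParents (w-child-treeOrLeaf wr′ r≢v) (HasTwoParents-lift two′)

partner : CV → CV
partner (sp j) = sq j
partner (sq j) = sp j
partner γ      = γ

index : CV → ℕ
index (lf j) = j
index (rv j) = j
index (sp j) = j
index (sq j) = j

IsSpine : CV → Set
IsSpine (sp _) = ⊤
IsSpine (sq _) = ⊤
IsSpine _      = ⊥

SpineVertex : ℕ → CV → Set
SpineVertex k γ = IsSpine γ × InLadder k γ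

SpineImage : ℕ → (CV → ℕ) → ℕ → Set
SpineImage k φ x = Σ CV λ γ → SpineVertex k γ × φ γ ≡ x

partner-≢ : ∀ {γ} → IsSpine γ → partner γ ≢ γ
partner-≢ {sp _} _ ()
partner-≢ {sq _} _ ()

module _ {k : ℕ} where

  spineArc⇒SpineVertex : ∀ {γ δ} → SpineArc k γ δ → SpineVertex k γ × SpineVertex k δ
  spineArc⇒SpineVertex s-one          = (tt , ≤-refl , ≤-refl) , (tt , ≤-refl , ≤-refl)
  spineArc⇒SpineVertex s-top          = (tt , s≤s z≤n , ≤-refl) , (tt , s≤s z≤n , n≤1+n _)
  spineArc⇒SpineVertex (s-qp _ j≥1 j<k) = (tt , j≥1 , ≤-trans (n≤1+n _) j<k) , (tt , s≤s z≤n , j<k)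
  spineArc⇒SpineVertex (s-pq _ j≥1 j+1<k) =
    (tt , s≤s z≤n , j+1<k) , (tt , j≥1 , ≤-trans (n≤1+n _) (≤-trans (n≤1+n _) j+1<k))
  spineArc⇒SpineVertex (s-bot k≥2)    = (tt , s≤s z≤n , k≥2) , (tt , ≤-refl , ≤-trans (s≤s z≤n) k≥2)

  partner-SpineVertex : ∀ {γ} → SpineVertex k γ → SpineVertex k (partner γ)
  partner-SpineVertex {sp _} (_ , γ∈) = tt , γ∈
  partner-SpineVertex {sq _} (_ , γ∈) = tt , γ∈

  SpineVertex-≢rv : ∀ {γ i} → SpineVertex k γ → γ ≢ rv i
  SpineVertex-≢rv {sp _} _ ()
  SpineVertex-≢rv {sq _} _ ()

  sp⋆sp₁ : ∀ {i} → 1 ≤ i → i ≤ k → Star (SpineArc k) (sp i) (sp 1)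
  sp⋆sp₁ {1} _ _ = ε
  sp⋆sp₁ {2} _ k≥2 = s-bot k≥2 ◅ ε
  sp⋆sp₁ {suc (suc (suc i))} _ i+3≤k =
    s-pq k≥2 (s≤s z≤n) i+3≤k ◅ s-qp k≥2 (s≤s z≤n) i+2≤k ◅ sp⋆sp₁ (s≤s z≤n) i+2≤k
    where
    i+2≤k : suc (suc i) ≤ k
    i+2≤k = ≤-trans (n≤1+n _) i+3≤k
    k≥2 : 2 ≤ k
    k≥2 = ≤-trans (s≤s (s≤s z≤n)) i+3≤k

  sq⋆sp-below : ∀ {j} → 1 ≤ j → suc j ≤ k → Star (SpineArc k) (sq j) (sp j)
  sq⋆sp-below {1} _ k≥2 = s-qp k≥2 ≤-refl k≥2 ◅ s-bot k≥2 ◅ ε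
  sq⋆sp-below {suc (suc j)} _ j+3≤k =
    s-qp k≥2 (s≤s z≤n) j+3≤k ◅ s-pq k≥2 (s≤s z≤n) j+3≤k ◅ s-qp k≥2 (s≤s z≤n) (≤-trans (n≤1+n _) j+3≤k) ◅ ε
    where
    k≥2 : 2 ≤ k
    k≥2 = ≤-trans (s≤s (s≤s z≤n)) j+3≤k

sqₖ⋆spₖ : ∀ {k} → 1 ≤ k → Star (SpineArc k) (sq k) (sp k)
sqₖ⋆spₖ {1} _ = s-one ◅ ε
sqₖ⋆spₖ {suc (suc m)} _ = s-top ◅ s-qp (s≤s (s≤s z≤n)) (s≤s z≤n) ≤-refl ◅ ε

sq⋆sp : ∀ {k j} → 1 ≤ j → j ≤ k → Star (SpineArc k) (sq j) (sp j)
sq⋆sp j≥1 j≤k with m≤n⇒m<n∨m≡n j≤k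
... | inj₁ j<k  = sq⋆sp-below j≥1 j<k
... | inj₂ refl = sqₖ⋆spₖ j≥1

SpineVertex⋆sp₁ : ∀ {k γ} → SpineVertex k γ → Star (SpineArc k) γ (sp 1)
SpineVertex⋆sp₁ {γ = sp _} (_ , i≥1 , i≤k) = sp⋆sp₁ i≥1 i≤k
SpineVertex⋆sp₁ {γ = sq _} (_ , i≥1 , i≤k) = sq⋆sp i≥1 i≤k ◅◅ sp⋆sp₁ i≥1 i≤k

spineArc-parent⊎⋆partner : ∀ {k γ δ} → SpineArc k γ δ →
                           Σ CV (λ ζ → SpineArc k ζ γ) ⊎ Star (SpineArc k) δ (partner γ)
spineArc-parent⊎⋆partner s-one = inj₂ ε
spineArc-parent⊎⋆partner s-top = inj₂ (s-qp (s≤s (s≤s z≤n)) (s≤s z≤n) ≤-refl ◅ ε)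
spineArc-parent⊎⋆partner (s-qp {j = 1} k≥2 _ _) = inj₂ (s-bot k≥2 ◅ ε)
spineArc-parent⊎⋆partner (s-qp {j = suc (suc j)} k≥2 _ j+3≤k) =
  inj₂ (s-pq k≥2 (s≤s z≤n) j+3≤k ◅ s-qp k≥2 (s≤s z≤n) (≤-trans (n≤1+n _) j+3≤k) ◅ ε)
spineArc-parent⊎⋆partner (s-pq k≥2 _ j+2≤k) = inj₁ (_ , s-qp k≥2 (s≤s z≤n) j+2≤k)
spineArc-parent⊎⋆partner (s-bot k≥2) = inj₁ (_ , s-qp k≥2 ≤-refl k≥2)

spineArc-child⊎partner⋆ : ∀ {k γ δ} → SpineArc k γ δ →
                          Σ CV (λ ζ → SpineArc k δ ζ) ⊎ Star (SpineArc k) (partner δ) γ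
spineArc-child⊎partner⋆ s-one = inj₂ ε
spineArc-child⊎partner⋆ s-top = inj₁ (_ , s-qp (s≤s (s≤s z≤n)) (s≤s z≤n) ≤-refl)
spineArc-child⊎partner⋆ (s-qp {j = 1} k≥2 _ _) = inj₁ (_ , s-bot k≥2)
spineArc-child⊎partner⋆ (s-qp {j = suc (suc j)} k≥2 _ j+3≤k) = inj₁ (_ , s-pq k≥2 (s≤s z≤n) j+3≤k)
spineArc-child⊎partner⋆ (s-pq k≥2 j≥1 j+2≤k) = inj₁ (_ , s-qp k≥2 j≥1 (≤-trans (n≤1+n _) j+2≤k))
spineArc-child⊎partner⋆ (s-bot k≥2) = inj₂ (s-qp k≥2 ≤-refl k≥2 ◅ ε)

module _ {L : List Arc} {k : ℕ} {φ : CV → ℕ} where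

  ⋆⇒walk : (∀ {γ δ} → SpineArc k γ δ → (φ γ , φ δ) ∈ L) →
           ∀ {γ δ} → Star (SpineArc k) γ δ → Walk L (SpineImage k φ) (φ γ) (φ δ)
  ⋆⇒walk arc ε       = wnil
  ⋆⇒walk arc (s ◅ r) = wcons (arc s) (_ , proj₂ (spineArc⇒SpineVertex s) , refl) (⋆⇒walk arc r)

  ⋆⇒Reach* : (∀ {γ δ} → SpineArc k γ δ → Reach⁺ L (φ γ) (φ δ)) →
             ∀ {γ δ} → Star (SpineArc k) γ δ → Reach* L (φ γ) (φ δ)
  ⋆⇒Reach* arc ε       = inj₁ refl
  ⋆⇒Reach* arc (s ◅ r) = inj₂ (arc s ⁺++* ⋆⇒Reach* arc r)

module Ladder {M : Network} {k : ℕ} {ℓ : ℕ → ℕ} {φ : CV → ℕ} (C : IsTCL M k ℓ φ) where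
  open IsTCL C

  injective : ∀ {γ δ} → InLadder k γ → InLadder k δ → φ γ ≡ φ δ → γ ≡ δ
  injective = φ-injective _ _

  rung : ∀ {γ} → SpineVertex k γ → (φ γ , φ (rv (index γ))) ∈ A M
  rung {sp j} (_ , j≥1 , j≤k) = P2-p j j≥1 j≤k
  rung {sq j} (_ , j≥1 , j≤k) = P2-q j j≥1 j≤k

  partner-rung : ∀ {γ} → SpineVertex k γ → (φ (partner γ) , φ (rv (index γ))) ∈ A M
  partner-rung {sp j} (_ , j≥1 , j≤k) = P2-q j j≥1 j≤k
  partner-rung {sq j} (_ , j≥1 , j≤k) = P2-p j j≥1 j≤k

  partner-image-≢ : ∀ {γ} → SpineVertex k γ → φ γ ≢ φ (partner γ)
  partner-image-≢ {γ} (s , γ∈) e =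
    partner-≢ s (sym (injective γ∈ (proj₂ (partner-SpineVertex {k} {γ} (s , γ∈))) e))

  rung-HasTwoParents : ∀ {γ} → SpineVertex k γ → HasTwoParents M (φ (rv (index γ)))
  rung-HasTwoParents γ∈ = _ , _ , rung γ∈ , partner-rung γ∈ , partner-image-≢ γ∈

  reticulation-HasTwoParents : ∀ {j} → 1 ≤ j → j ≤ k → HasTwoParents M (φ (rv j))
  reticulation-HasTwoParents {j} j≥1 j≤k = rung-HasTwoParents {sp j} (tt , j≥1 , j≤k)

  images-≢ : ∀ {γ δ} → InLadder k γ → InLadder k δ → γ ≢ δ → φ γ ≢ φ δ
  images-≢ γ∈ δ∈ γ≢δ e = γ≢δ (injective γ∈ δ∈ e)

  pendantRoot : ℕ → ℕ
  pendantRoot zero    = φ (sp 1)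
  pendantRoot (suc j) = φ (rv (suc j))

  pendantRoot-injective : ∀ {i j} → i ≤ k → j ≤ k → pendantRoot i ≡ pendantRoot j → i ≡ j
  pendantRoot-injective {zero}  {zero}  _ _ _ = refl
  pendantRoot-injective {zero}  {suc j} _ j≤k e with injective (≤-refl , k≥1) (s≤s z≤n , j≤k) e
  ... | ()
  pendantRoot-injective {suc i} {zero}  i≤k _ e with injective (s≤s z≤n , i≤k) (≤-refl , k≥1) e
  ... | ()
  pendantRoot-injective {suc i} {suc j} i≤k j≤k e with injective (s≤s z≤n , i≤k) (s≤s z≤n , j≤k) e
  ... | refl = refl

  pendantPath : ∀ {j} → j ≤ k → TreePath M (pendantRoot j) (ℓ j)
  pendantPath {zero}  _   = P1-root
  pendantPath {suc j} j≤k = P1-rets (suc j) (s≤s z≤n) j≤k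

module DeletedLadder {N : Network} (ph : IsPhyloNetwork N) (tc : TreeChild N)
                     {u v w b : ℕ} (uv : (u , v) ∈ A N) (wv : (w , v) ∈ A N) (u≢w : u ≢ w)
                     (ub : (u , b) ∈ A N) (b≢v : b ≢ v) (C′ : TCL (N ∖ (u , v))) where
  open TreeChildNetwork ph tc
  open ArcDeletion ph tc uv wv u≢w ub b≢v public
  module C′ = IsTCL (isTCL C′)
  open Ladder (isTCL C′)

  k′ : ℕ
  k′ = k C′

  φ′ : CV → ℕ
  φ′ = φ C′

  rung-in-N : ∀ {γ} → SpineVertex k′ γ → (φ′ γ , φ′ (rv (index γ))) ∈ A N
  rung-in-N γ∈ = HasTwoParents′⇒parent-arc (rung γ∈) (partner-rung γ∈) (partner-image-≢ γ∈)

  partner-rung-in-N : ∀ {γ} → SpineVertex k′ γ → (φ′ (partner γ) , φ′ (rv (index γ))) ∈ A N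
  partner-rung-in-N γ∈ = HasTwoParents′⇒parent-arc (partner-rung γ∈) (rung γ∈) (≢-sym (partner-image-≢ γ∈))

  rung-HasTwoParents-in-N : ∀ {γ} → SpineVertex k′ γ → HasTwoParents N (φ′ (rv (index γ)))
  rung-HasTwoParents-in-N γ∈ = HasTwoParents-lift (rung-HasTwoParents γ∈)

  spine-image-≢w : ∀ {γ} → SpineVertex k′ γ → φ′ γ ≢ w
  spine-image-≢w γ∈ e =
    w-child′-¬HasTwoParents (subst (λ x → (x , _) ∈ A N′) e (rung γ∈)) (rung-HasTwoParents γ∈)

  spine-image-¬HasTwoParents : ∀ {γ} → SpineVertex k′ γ → ¬ HasTwoParents N (φ′ γ)
  spine-image-¬HasTwoParents γ∈ two =
    treeOrLeaf⇒¬HasTwoParents (reticulation-child-treeOrLeaf two (rung-in-N γ∈))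
                              (rung-HasTwoParents-in-N γ∈)

  core∉X : ∀ γ → NonLeaf γ → InLadder k′ γ → φ′ γ ∉ X N
  core∉X (rv j) _ (j≥1 , j≤k) = HasTwoParents⇒∉X (HasTwoParents-lift (reticulation-HasTwoParents j≥1 j≤k))
  core∉X (sp j) _ γ∈ = tail∉X (rung-in-N {sp j} (tt , γ∈))
  core∉X (sq j) _ γ∈ = tail∉X (rung-in-N {sq j} (tt , γ∈))

  ⋆′⇒Reach* : ∀ {γ δ} → Star (SpineArc k′) γ δ → Reach* (A N) (φ′ γ) (φ′ δ)
  ⋆′⇒Reach* = ⋆⇒Reach* (λ s → arc′⇒Reach⁺ (C′.P3 _ _ s))

  spine-parent⊎reaches-partner : ∀ {γ δ} → SpineArc k′ γ δ →
                                 Σ CV (λ ζ → SpineArc k′ ζ γ) ⊎ Reach* (A N) (φ′ δ) (φ′ (partner γ))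
  spine-parent⊎reaches-partner s = map-⊎ id ⋆′⇒Reach* (spineArc-parent⊎⋆partner s)

  spine-child⊎partner-reaches : ∀ {γ δ} → SpineArc k′ γ δ →
                                Σ CV (λ ζ → SpineArc k′ δ ζ) ⊎ Reach* (A N) (φ′ (partner δ)) (φ′ γ)
  spine-child⊎partner-reaches s = map-⊎ id ⋆′⇒Reach* (spineArc-child⊎partner⋆ s)

  -- The rung of γ must be the reticulation child y of x, whose other parent is then the
  -- partner of γ.
  partner-forced : ∀ {γ x y t x′} → SpineVertex k′ γ → φ′ γ ≡ x →
                   (x , y) ∈ A N → (x , t) ∈ A N → y ≢ t → ¬ HasTwoParents N t →
                   (x′ , y) ∈ A N → x′ ≢ x → φ′ (partner γ) ≡ x′
  partner-forced {γ} γ∈ refl xy xt y≢t ¬two-t x′y x′≢x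
    with twoChildren-child-one-of xy xt y≢t (rung-in-N γ∈)
  ... | inj₂ r≡t = contradiction (subst (HasTwoParents N) r≡t (rung-HasTwoParents-in-N γ∈)) ¬two-t
  ... | inj₁ r≡y with HasTwoParents-parent-one-of xy x′y (≢-sym x′≢x)
                        (subst (λ r → (_ , r) ∈ A N) r≡y (partner-rung-in-N γ∈))
  ...   | inj₁ e = contradiction (sym e) (partner-image-≢ γ∈)
  ...   | inj₂ e = e

  -- The hypothesis that needs e to be the first or last rung of a ladder of N.
  BypassFree : Set
  BypassFree = ∀ {a γ δ} → (a , u) ∈ A N → SpineArc k′ γ δ → φ′ γ ≡ a → φ′ δ ≡ b → ⊥

relabel : (ℕ → ℕ) → (CV → ℕ) → CV → ℕ
relabel L φ (lf j) = L j
relabel L φ γ      = φ γ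

relabel-core : ∀ {L φ} γ → NonLeaf γ → relabel L φ γ ≡ φ γ
relabel-core (rv _) _ = refl
relabel-core (sp _) _ = refl
relabel-core (sq _) _ = refl

leaf⊎NonLeaf : ∀ γ → Σ ℕ (λ j → γ ≡ lf j) ⊎ NonLeaf γ
leaf⊎NonLeaf (lf j) = inj₁ (j , refl)
leaf⊎NonLeaf (rv _) = inj₂ tt
leaf⊎NonLeaf (sp _) = inj₂ tt
leaf⊎NonLeaf (sq _) = inj₂ tt

relabel-injective : ∀ {k L φ} {S : ℕ → Set} →
  (∀ i j → i ≤ k → j ≤ k → L i ≡ L j → i ≡ j) → (∀ j → j ≤ k → S (L j)) →
  (∀ γ → NonLeaf γ → InLadder k γ → ¬ S (φ γ)) →
  (∀ γ δ → InLadder k γ → InLadder k δ → φ γ ≡ φ δ → γ ≡ δ) →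
  ∀ γ δ → InLadder k γ → InLadder k δ → relabel L φ γ ≡ relabel L φ δ → γ ≡ δ
relabel-injective {S = S} L-inj S-L ¬S-core φ-inj γ δ γ∈ δ∈ e with leaf⊎NonLeaf γ | leaf⊎NonLeaf δ
... | inj₁ (i , refl) | inj₁ (j , refl) = cong lf (L-inj i j γ∈ δ∈ e)
... | inj₁ (i , refl) | inj₂ nδ =
  ⊥-elim (¬S-core δ nδ δ∈ (subst S (trans e (relabel-core δ nδ)) (S-L i γ∈)))
... | inj₂ nγ | inj₁ (j , refl) =
  ⊥-elim (¬S-core γ nγ γ∈ (subst S (trans (sym e) (relabel-core γ nγ)) (S-L j δ∈)))
... | inj₂ nγ | inj₂ nδ =
  φ-inj γ δ γ∈ δ∈ (trans (sym (relabel-core γ nγ)) (trans e (relabel-core δ nδ)))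

cores-agree⇒Equivalent : ∀ {M M′} (C : TCL M) (D : TCL M′) → k C ≡ k D →
                         (∀ γ → NonLeaf γ → φ C γ ≡ φ D γ) → Equivalent C D
cores-agree⇒Equivalent C D k≡ agree x = mk⇔
  (λ { (γ , nγ , γ∈ , e) → γ , nγ , subst (λ k → InLadder k γ) k≡ γ∈ , trans (sym (agree γ nγ)) e })
  (λ { (γ , nγ , γ∈ , e) → γ , nγ , subst (λ k → InLadder k γ) (sym k≡) γ∈ , trans (agree γ nγ) e })

choose≤ : ∀ {P : ℕ → ℕ → Set} k → (∀ j → j ≤ k → Σ ℕ (P j)) →
          Σ (ℕ → ℕ) λ f → ∀ j → j ≤ k → P j (f j)
choose≤ {P} k g = (λ j → pick j (j ≤? k)) , pick-spec
  where
  pick : ∀ j → Dec (j ≤ k) → ℕ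
  pick j (yes j≤k) = proj₁ (g j j≤k)
  pick j (no _)    = 0
  pick-spec : ∀ j → j ≤ k → P j (pick j (j ≤? k))
  pick-spec j j≤k with j ≤? k
  ... | yes j≤k′ = proj₂ (g j j≤k′)
  ... | no j≰k   = contradiction j≤k j≰k

module Transfer {N : Network} (ph : IsPhyloNetwork N) (tc : TreeChild N)
                {u v w b : ℕ} (uv : (u , v) ∈ A N) (wv : (w , v) ∈ A N) (u≢w : u ≢ w)
                (ub : (u , b) ∈ A N) (b≢v : b ≢ v) (C′ : TCL (N ∖ (u , v)))
                (bypass-free : DeletedLadder.BypassFree ph tc uv wv u≢w ub b≢v C′) where
  open IsPhyloNetwork ph using (acyclic)
  open TreeChildNetwork ph tc
  open DeletedLadder ph tc uv wv u≢w ub b≢v C′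
  open Ladder (isTCL C′)

  spineArc-in-N : ∀ {γ δ} → SpineArc k′ γ δ → (φ′ γ , φ′ δ) ∈ A N
  spineArc-in-N s with residual (C′.P3 _ _ s)
  ... | via-u au δ≡b     = ⊥-elim (bypass-free au s refl δ≡b)
  ... | via-v γ≡w _      = contradiction γ≡w (spine-image-≢w (proj₁ (spineArc⇒SpineVertex s)))
  ... | kept γδ _ _ _ _  = γδ

  reticulation-¬treePath-sp₁ : ∀ {i} → 1 ≤ i → i ≤ k′ → ¬ TreePath N (φ′ (rv i)) (φ′ (sp 1))
  reticulation-¬treePath-sp₁ {i} i≥1 i≤k p
    with treePath-walk-comparable p (⋆⇒walk spineArc-in-N (sp⋆sp₁ i≥1 i≤k))
  ... | inj₂ p′ = acyclic _ (one (rung-in-N {sp i} (tt , i≥1 , i≤k)) ⁺++* treePath⇒Reach* p′)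
  ... | inj₁ spine-walk with walk-end spine-walk
  ...   | inj₁ e            =
    SpineVertex-≢rv {k′} {sp i} (tt , i≥1 , i≤k) (injective (i≥1 , i≤k) (i≥1 , i≤k) e)
  ...   | inj₂ (γ , γ∈ , e) = SpineVertex-≢rv γ∈ (injective (proj₂ γ∈) (i≥1 , i≤k) e)

  pendantRoot-treePath⇒≡ : ∀ {i j} → i ≤ k′ → j ≤ k′ →
                           TreePath N (pendantRoot i) (pendantRoot j) → i ≡ j
  pendantRoot-treePath⇒≡ {zero}  {zero}  _   _ _ = refl
  pendantRoot-treePath⇒≡ {suc i} {zero}  i≤k _ p = ⊥-elim (reticulation-¬treePath-sp₁ (s≤s z≤n) i≤k p)
  pendantRoot-treePath⇒≡ {i}     {suc j} i≤k j≤k p with treePath-end p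
  ... | inj₁ e = pendantRoot-injective i≤k j≤k e
  ... | inj₂ t = contradiction (HasTwoParents-lift (reticulation-HasTwoParents (s≤s z≤n) j≤k))
                               (treeOrLeaf⇒¬HasTwoParents t)

  converging-treePaths⇒≡ : ∀ {i j z} → i ≤ k′ → j ≤ k′ →
                           TreePath N (pendantRoot i) z → TreePath N (pendantRoot j) z → i ≡ j
  converging-treePaths⇒≡ i≤k j≤k p q with treePaths-comparable p q
  ... | inj₁ j⇝i = sym (pendantRoot-treePath⇒≡ j≤k i≤k j⇝i)
  ... | inj₂ i⇝j = pendantRoot-treePath⇒≡ i≤k j≤k i⇝j

  PendantLeaves : (ℕ → ℕ) → Set
  PendantLeaves L = ∀ j → j ≤ k′ → L j ∈ X N × TreePath N (pendantRoot j) (L j)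

  relabel-IsTCL : ∀ L → PendantLeaves L → IsTCL N k′ L (relabel L φ′)
  relabel-IsTCL L pendant = record
    { k≥1             = C′.k≥1
    ; labels-distinct = L-injective
    ; labels-in-X     = λ j j≤k → proj₁ (pendant j j≤k)
    ; φ-vertex        = vertex
    ; φ-injective     = relabel-injective {S = _∈ X N} L-injective (λ j j≤k → proj₁ (pendant j j≤k))
                                          core∉X C′.φ-injective
    ; φ-leaf          = λ _ _ → refl
    ; P1-root         = proj₂ (pendant 0 z≤n)
    ; P1-rets         = λ { (suc j) _ j≤k → proj₂ (pendant (suc j) j≤k) }
    ; P2-p            = λ j j≥1 j≤k → rung-in-N {sp j} (tt , j≥1 , j≤k)
    ; P2-q            = λ j j≥1 j≤k → rung-in-N {sq j} (tt , j≥1 , j≤k)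
    ; P3              = spine
    }
    where
    L-injective : ∀ i j → i ≤ k′ → j ≤ k′ → L i ≡ L j → i ≡ j
    L-injective i j i≤k j≤k e =
      converging-treePaths⇒≡ i≤k j≤k (proj₂ (pendant i i≤k))
                                     (subst (TreePath N _) (sym e) (proj₂ (pendant j j≤k)))
    vertex : ∀ γ → InLadder k′ γ → relabel L φ′ γ ∈ V N
    vertex (lf j) j≤k = proj₁ (IsPhyloNetwork.leaves ph _ (proj₁ (pendant j j≤k)))
    vertex (rv j) γ∈  = V′⊆V (C′.φ-vertex _ γ∈)
    vertex (sp j) γ∈  = V′⊆V (C′.φ-vertex _ γ∈)
    vertex (sq j) γ∈  = V′⊆V (C′.φ-vertex _ γ∈)
    spine : ∀ γ δ → SpineArc k′ γ δ → (relabel L φ′ γ , relabel L φ′ δ) ∈ A N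
    spine _ _ s@s-one          = spineArc-in-N s
    spine _ _ s@s-top          = spineArc-in-N s
    spine _ _ s@(s-qp _ _ _)   = spineArc-in-N s
    spine _ _ s@(s-pq _ _ _)   = spineArc-in-N s
    spine _ _ s@(s-bot _)      = spineArc-in-N s

  transfer : ∀ {x₀} → x₀ ∈ X N → TreePath N w x₀ → Σ (TCL N) λ D → Equivalent D C′
  transfer {x₀} x₀∈X w⇝x₀ =
    D , cores-agree⇒Equivalent D C′ refl relabel-core
    where
    pendant-leaf : ∀ j → j ≤ k′ → Σ ℕ λ x → x ∈ X N × TreePath N (pendantRoot j) x
    pendant-leaf j j≤k with treePath-lift (pendantPath j≤k)
    ... | inj₁ p = ℓ C′ j , subst (ℓ C′ j ∈_) X′≡X (C′.labels-in-X j j≤k) , p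
    ... | inj₂ p = x₀ , x₀∈X , p ++ᵗ w⇝x₀
    L : ℕ → ℕ
    L = proj₁ (choose≤ k′ pendant-leaf)
    pendant : PendantLeaves L
    pendant = proj₂ (choose≤ k′ pendant-leaf)
    D : TCL N
    D = mkTCL k′ L (relabel L φ′) (relabel-IsTCL L pendant)

module TreeChildLadder {N : Network} (ph : IsPhyloNetwork N) (tc : TreeChild N)
                       {K : ℕ} {ℓ : ℕ → ℕ} {φ : CV → ℕ} (C : IsTCL N K ℓ φ) where
  open TreeChildNetwork ph tc
  open IsTCL C using (P1-root; P3; labels-in-X)
  open Ladder C

  ⋆⇒Reach*-in-N : ∀ {γ δ} → Star (SpineArc K) γ δ → Reach* (A N) (φ γ) (φ δ)
  ⋆⇒Reach*-in-N = ⋆⇒Reach* (λ s → one (P3 _ _ s))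

  ⋆-treePath : ∀ {γ δ} → Star (SpineArc K) γ δ → TreePath N (φ δ) (ℓ 0) → TreePath N (φ γ) (ℓ 0)
  ⋆-treePath ε p = p
  ⋆-treePath (_◅_ {j = ζ} s r) p = step (P3 _ _ s) ζ-treeOrLeaf ζ⇝ℓ₀
    where
    ζ∈ : SpineVertex K ζ
    ζ∈ = proj₂ (spineArc⇒SpineVertex s)
    ζ⇝ℓ₀ : TreePath N (φ ζ) (ℓ 0)
    ζ⇝ℓ₀ = ⋆-treePath r p
    ζ-treeOrLeaf : TreeOrLeaf N (φ ζ)
    ζ-treeOrLeaf =
      reticulationParent-treeOrLeaf (P3 _ _ s) (rung ζ∈) (rung-HasTwoParents ζ∈) ζ⇝ℓ₀ (labels-in-X 0 z≤n)

  spine-treePath : ∀ {γ} → SpineVertex K γ → TreePath N (φ γ) (ℓ 0)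
  spine-treePath γ∈ = ⋆-treePath (SpineVertex⋆sp₁ γ∈) P1-root

module FirstRung {N : Network} (ph : IsPhyloNetwork N) (tc : TreeChild N)
                 {K : ℕ} {ℓ : ℕ → ℕ} {φ : CV → ℕ} (C : IsTCL N K ℓ φ) where
  open IsPhyloNetwork ph using (acyclic)
  open TreeChildNetwork ph tc
  open IsTCL C using (k≥1; P1-root; P3; labels-in-X)
  open Ladder C
  open TreeChildLadder ph tc C

  private
    sp₁∈ : SpineVertex K (sp 1)
    sp₁∈ = tt , ≤-refl , k≥1

    p₁v₁ : (φ (sp 1) , φ (rv 1)) ∈ A N
    p₁v₁ = rung {sp 1} sp₁∈

    q₁v₁ : (φ (sq 1) , φ (rv 1)) ∈ A N
    q₁v₁ = partner-rung {sp 1} sp₁∈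

    p₁≢q₁ : φ (sp 1) ≢ φ (sq 1)
    p₁≢q₁ = partner-image-≢ {sp 1} sp₁∈

    p₁-treeChild : Σ ℕ λ b → (φ (sp 1) , b) ∈ A N × TreeOrLeaf N b
    p₁-treeChild = treePath-first-arc p₁v₁ P1-root (labels-in-X 0 z≤n)

    b : ℕ
    b = proj₁ p₁-treeChild

    p₁b : (φ (sp 1) , b) ∈ A N
    p₁b = proj₁ (proj₂ p₁-treeChild)

    b≢v₁ : b ≢ φ (rv 1)
    b≢v₁ b≡v₁ = treeOrLeaf⇒¬HasTwoParents (subst (TreeOrLeaf N) b≡v₁ (proj₂ (proj₂ p₁-treeChild)))
                                          (reticulation-HasTwoParents ≤-refl k≥1)

  module _ (C′ : TCL (N ∖ (φ (sp 1) , φ (rv 1)))) where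
    open DeletedLadder ph tc p₁v₁ q₁v₁ p₁≢q₁ p₁b b≢v₁ C′

    module _ (K≥2 : 2 ≤ K) where
      private
        sp₂∈ : SpineVertex K (sp 2)
        sp₂∈ = tt , s≤s z≤n , K≥2

        p₂p₁ : (φ (sp 2) , φ (sp 1)) ∈ A N
        p₂p₁ = P3 _ _ (s-bot K≥2)

        v₂≢p₁ : φ (rv 2) ≢ φ (sp 1)
        v₂≢p₁ = images-≢ (s≤s z≤n , K≥2) (≤-refl , k≥1) (λ ())

        p₂-parent-unique : ∀ {x} → (x , φ (sp 2)) ∈ A N → x ≡ φ (sq 1)
        p₂-parent-unique xp₂ =
          twoChildren-parent-unique (rung {sp 2} sp₂∈) p₂p₁ v₂≢p₁ xp₂ (P3 _ _ (s-qp K≥2 ≤-refl K≥2))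

        q₂⇝b : Reach⁺ (A N) (φ (sq 2)) b
        q₂⇝b = ⋆⇒Reach*-in-N (sq⋆sp (s≤s z≤n) K≥2) *++⁺ more p₂p₁ (one p₁b)

        p₁-parent-partner : ∀ {γ} → SpineVertex k′ γ → (φ′ γ , φ (sp 1)) ∈ A N →
                            φ′ (partner γ) ≡ φ (sq 2)
        p₁-parent-partner γ∈ γp₁ =
          partner-forced γ∈ (u-parent-unique γp₁ p₂p₁) (rung {sp 2} sp₂∈) p₂p₁ v₂≢p₁
            (treeVertex⇒¬HasTwoParents {N} (u-treeVertex γp₁))
            (partner-rung {sp 2} sp₂∈) (≢-sym (partner-image-≢ {sp 2} sp₂∈))

      -- A bypass spine arc (p₂ , b) would make q₂ the partner of its tail: either the spine
      -- leads from b back to q₂, closing the cycle q₂ ⇝ p₂ → p₁ → b, or the tail p₂ has a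
      -- spine parent, which can only be q₁ = w.
      bypass-free-K≥2 : BypassFree
      bypass-free-K≥2 γp₁ s refl δ≡b with spine-parent⊎reaches-partner s
      ... | inj₂ δ⇝partner =
        acyclic b (subst₂ (Reach* (A N)) δ≡b (p₁-parent-partner (proj₁ (spineArc⇒SpineVertex s)) γp₁)
                          δ⇝partner
                   *++⁺ q₂⇝b)
      ... | inj₁ (ζ , s′) with residual (C′.P3 _ _ s′)
      ...   | via-u _ γ≡b =
        acyclic b (subst (λ x → Reach⁺ (A N) x b) (trans (sym (u-parent-unique γp₁ p₂p₁)) γ≡b)
                         (more p₂p₁ (one p₁b)))
      ...   | via-v ζ≡w _ = spine-image-≢w (proj₁ (spineArc⇒SpineVertex s′)) ζ≡w
      ...   | kept ζγ _ _ _ _ =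
        spine-image-≢w (proj₁ (spineArc⇒SpineVertex s′))
          (p₂-parent-unique (subst (λ x → (_ , x) ∈ A N) (u-parent-unique γp₁ p₂p₁) ζγ))

    bypass-free : BypassFree
    bypass-free γp₁ s γ≡a δ≡b with m≤n⇒m<n∨m≡n k≥1
    ... | inj₁ K≥2 = bypass-free-K≥2 K≥2 γp₁ s γ≡a δ≡b
    ... | inj₂ K≡1 =
      spine-image-≢w (proj₁ (spineArc⇒SpineVertex s)) (trans γ≡a (u-parent-unique γp₁ q₁p₁))
      where
      q₁p₁ : (φ (sq 1) , φ (sp 1)) ∈ A N
      q₁p₁ = P3 _ _ (subst (λ k → SpineArc k (sq 1) (sp 1)) K≡1 s-one)

    result : Σ (TCL N) λ D → Equivalent D C′
    result = Transfer.transfer ph tc p₁v₁ q₁v₁ p₁≢q₁ p₁b b≢v₁ C′ bypass-free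
               (labels-in-X 0 z≤n) (spine-treePath {sq 1} (tt , ≤-refl , k≥1))

module LastRungOfShortLadder {N : Network} (ph : IsPhyloNetwork N) (tc : TreeChild N)
                             {ℓ : ℕ → ℕ} {φ : CV → ℕ} (C : IsTCL N 1 ℓ φ) where
  open IsTCL C using (P1-root; P3; labels-in-X)
  open Ladder C

  private
    sq₁∈ : SpineVertex 1 (sq 1)
    sq₁∈ = tt , ≤-refl , ≤-refl

    q₁v₁ : (φ (sq 1) , φ (rv 1)) ∈ A N
    q₁v₁ = rung {sq 1} sq₁∈

    p₁v₁ : (φ (sp 1) , φ (rv 1)) ∈ A N
    p₁v₁ = partner-rung {sq 1} sq₁∈

    q₁≢p₁ : φ (sq 1) ≢ φ (sp 1)
    q₁≢p₁ = partner-image-≢ {sq 1} sq₁∈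

    p₁≢v₁ : φ (sp 1) ≢ φ (rv 1)
    p₁≢v₁ = images-≢ (≤-refl , ≤-refl) (≤-refl , ≤-refl) (λ ())

  module _ (C′ : TCL (N ∖ (φ (sq 1) , φ (rv 1)))) where
    open DeletedLadder ph tc q₁v₁ p₁v₁ q₁≢p₁ (P3 _ _ s-one) p₁≢v₁ C′

    bypass-free : BypassFree
    bypass-free _ s _ δ≡p₁ = spine-image-≢w (proj₂ (spineArc⇒SpineVertex s)) δ≡p₁

    result : Σ (TCL N) λ D → Equivalent D C′
    result = Transfer.transfer ph tc q₁v₁ p₁v₁ q₁≢p₁ (P3 _ _ s-one) p₁≢v₁ C′ bypass-free
               (labels-in-X 0 z≤n) P1-root

module LastRungOfLongLadder {N : Network} (ph : IsPhyloNetwork N) (tc : TreeChild N)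
                            {m : ℕ} {ℓ : ℕ → ℕ} {φ : CV → ℕ} (C : IsTCL N (suc (suc m)) ℓ φ) where
  open IsPhyloNetwork ph using (acyclic)
  open TreeChildNetwork ph tc
  open IsTCL C using (P3; labels-in-X)
  open Ladder C
  open TreeChildLadder ph tc C

  private
    K K₋ : ℕ
    K  = suc (suc m)
    K₋ = suc m

    sqₖ∈ : SpineVertex K (sq K)
    sqₖ∈ = tt , s≤s z≤n , ≤-refl

    sqₖ₋∈ : SpineVertex K (sq K₋)
    sqₖ₋∈ = tt , s≤s z≤n , n≤1+n _

    qₖvₖ : (φ (sq K) , φ (rv K)) ∈ A N
    qₖvₖ = rung {sq K} sqₖ∈

    pₖvₖ : (φ (sp K) , φ (rv K)) ∈ A N
    pₖvₖ = partner-rung {sq K} sqₖ∈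

    qₖ≢pₖ : φ (sq K) ≢ φ (sp K)
    qₖ≢pₖ = partner-image-≢ {sq K} sqₖ∈

    qₖqₖ₋ : (φ (sq K) , φ (sq K₋)) ∈ A N
    qₖqₖ₋ = P3 _ _ s-top

    qₖ₋pₖ : (φ (sq K₋) , φ (sp K)) ∈ A N
    qₖ₋pₖ = P3 _ _ (s-qp (s≤s (s≤s z≤n)) (s≤s z≤n) ≤-refl)

    qₖ₋≢vₖ : φ (sq K₋) ≢ φ (rv K)
    qₖ₋≢vₖ = images-≢ (proj₂ sqₖ₋∈) (proj₂ sqₖ∈) (λ ())

    vₖ₋≢pₖ : φ (rv K₋) ≢ φ (sp K)
    vₖ₋≢pₖ = images-≢ (proj₂ sqₖ₋∈) (proj₂ sqₖ∈) (λ ())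

  module _ (C′ : TCL (N ∖ (φ (sq K) , φ (rv K)))) where
    open DeletedLadder ph tc qₖvₖ pₖvₖ qₖ≢pₖ qₖqₖ₋ qₖ₋≢vₖ C′

    private
      qₖ₋-partner : ∀ {δ} → SpineVertex k′ δ → φ′ δ ≡ φ (sq K₋) → φ′ (partner δ) ≡ φ (sp K₋)
      qₖ₋-partner δ∈ δ≡qₖ₋ =
        partner-forced δ∈ δ≡qₖ₋ (rung {sq K₋} sqₖ₋∈) qₖ₋pₖ vₖ₋≢pₖ w-¬HasTwoParents
          (partner-rung {sq K₋} sqₖ₋∈) (≢-sym (partner-image-≢ {sq K₋} sqₖ₋∈))

      qₖ₋-spine-child : ∀ {ζ} → SpineVertex k′ ζ → (φ (sq K₋) , φ′ ζ) ∈ A N → ⊥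
      qₖ₋-spine-child ζ∈ qₖ₋ζ with twoChildren-child-one-of (rung {sq K₋} sqₖ₋∈) qₖ₋pₖ vₖ₋≢pₖ qₖ₋ζ
      ... | inj₁ ζ≡vₖ₋ = spine-image-¬HasTwoParents ζ∈
                           (subst (HasTwoParents N) (sym ζ≡vₖ₋)
                                  (reticulation-HasTwoParents (s≤s z≤n) (n≤1+n _)))
      ... | inj₂ ζ≡pₖ  = spine-image-≢w ζ∈ ζ≡pₖ

      γ⇝pₖ₋ : ∀ {γ} → (φ′ γ , φ (sq K)) ∈ A N → Reach⁺ (A N) (φ′ γ) (φ (sp K₋))
      γ⇝pₖ₋ γqₖ = more γqₖ (one qₖqₖ₋ ⁺++* ⋆⇒Reach*-in-N (sq⋆sp (s≤s z≤n) (n≤1+n _)))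

    -- A bypass spine arc (a , qₖ₋₁) would make pₖ₋₁ the partner of its head: either the spine
    -- leads from pₖ₋₁ back to a, closing the cycle a → qₖ → qₖ₋₁ ⇝ pₖ₋₁, or the head qₖ₋₁ has
    -- a spine child, which can only be vₖ₋₁ or pₖ = w.
    bypass-free : BypassFree
    bypass-free {γ = γ} {δ} γqₖ s refl δ≡qₖ₋ with spine-child⊎partner-reaches s
    ... | inj₂ partner⇝γ =
      acyclic _ (subst (λ x → Reach* (A N) x (φ′ γ))
                       (qₖ₋-partner (proj₂ (spineArc⇒SpineVertex s)) δ≡qₖ₋) partner⇝γ
                 *++⁺ γ⇝pₖ₋ γqₖ)
    ... | inj₁ (ζ , s′) with residual (C′.P3 _ _ s′)
    ...   | via-u δqₖ _ = acyclic _ (more (subst (λ x → (x , _) ∈ A N) δ≡qₖ₋ δqₖ) (one qₖqₖ₋))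
    ...   | via-v δ≡pₖ _ = spine-image-≢w (proj₂ (spineArc⇒SpineVertex s)) δ≡pₖ
    ...   | kept δζ _ _ _ _ =
      qₖ₋-spine-child (proj₂ (spineArc⇒SpineVertex s′)) (subst (λ x → (x , _) ∈ A N) δ≡qₖ₋ δζ)

    result : Σ (TCL N) λ D → Equivalent D C′
    result = Transfer.transfer ph tc qₖvₖ pₖvₖ qₖ≢pₖ qₖqₖ₋ qₖ₋≢vₖ C′ bypass-free
               (labels-in-X 0 z≤n) (spine-treePath {sp K} (tt , s≤s z≤n , ≤-refl))

lemma13 : (N : Network) → IsPhyloNetwork N → TreeChild N →
          (C : TCL N) → (e : Arc) → (e ≡ firstRung C ⊎ e ≡ lastRung C) →
          (C' : TCL (N ∖ e)) →
          (Σ (CV → ℕ) λ ψ → IsTCL N (k C') (ℓ C') ψ)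
          ⊎ (Σ (TCL N) λ D → Equivalent D C')
lemma13 N ph tc (mkTCL K ℓ φ C) _ (inj₁ refl) C′ = inj₂ (FirstRung.result ph tc C C′)
lemma13 N ph tc (mkTCL zero ℓ φ C) _ (inj₂ refl) C′ with IsTCL.k≥1 C
... | ()
lemma13 N ph tc (mkTCL 1 ℓ φ C) _ (inj₂ refl) C′ = inj₂ (LastRungOfShortLadder.result ph tc C C′)
lemma13 N ph tc (mkTCL (suc (suc m)) ℓ φ C) _ (inj₂ refl) C′ =
  inj₂ (LastRungOfLongLadder.result ph tc C C′)
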